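{- For all integers $r\ge 2$ and $t\ge 2$, there exist infinitely many $r$-edge-connected $r$-regular $t$-uniform hypergraphs which do not have a Berge $k$-factor for any integer $k$ with $k>\frac{2}{t}r$.
   Context: A hypergraph has a finite vertex set and a finite multiset of edges, each a vertex subset of size at least two; it is $t$-uniform if every edge has exactly $t$ vertices, and $r$-regular if every vertex lies in exactly $r$ edges. A Berge-path is an alternating sequence of distinct vertices and distinct edges $v_1,e_1,\dots,e_l,v_{l+1}$ with $\{v_i,v_{i+1}\}\subseteq e_i$; the hypergraph is $\lambda$-edge-connected if after deleting any at most $\lambda-1$ edges every two vertices are still joined by a Berge-path. A Berge $k$-factor is a spanning subhypergraph $\mathcal{H}'$ (same vertex set, sub-multiset of edges) for which there is a $k$-regular graph $G$ (multiple edges allowed) on the same vertex set and a bijection $\phi:E(G)\to E(\mathcal{H}')$ with $e\subseteq\phi(e)$ for all $e$. -}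

module Defs where

open import Data.Nat using (ℕ; zero; suc; _+_; _*_; _∸_; _≤_; _<_)
open import Data.Bool using (Bool; true; false; _∨_; if_then_else_)
open import Data.Fin using (Fin; zero; suc; _≟_)
open import Data.Fin.Subset using (Subset; _∈_; _∉_; ∣_∣)
open import Data.Vec using (lookup)
open import Data.List using (List; []; _∷_)
open import Data.List.Relation.Unary.Unique.Propositional using (Unique)
open import Data.Product using (Σ; _×_; _,_; ∃; ∃-syntax)
open import Relation.Binary.PropositionalEquality using (_≡_; _≢_)
open import Relation.Nullary.Decidable using (⌊_⌋)
open import Function.Definitions using (Injective)

count : ∀ {p} → (Fin p → Bool) → ℕ
count {zero}  f = 0
count {suc p} f = (if f zero then 1 else 0) + count (λ i → f (suc i))

-- A hypergraph: vertex set Fin n, edge multiset indexed by Fin m,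
-- each edge a vertex subset of size at least two.
record Hypergraph : Set where
  field
    n     : ℕ
    m     : ℕ
    edge  : Fin m → Subset n
    edge≥2 : ∀ e → 2 ≤ ∣ edge e ∣
open Hypergraph public

Uniform : ℕ → Hypergraph → Set
Uniform t H = ∀ e → ∣ edge H e ∣ ≡ t

degree : (H : Hypergraph) → Fin (n H) → ℕ
degree H v = count (λ e → lookup (edge H e) v)

Regular : ℕ → Hypergraph → Set
Regular r H = ∀ v → degree H v ≡ r

-- Berge walks using only edges satisfying `allowed`, recording the
-- sequence of vertices and of edges: v₁, e₁, v₂, …, eₗ, vₗ₊₁.
data Walk (H : Hypergraph) (allowed : Fin (m H) → Set)
     : Fin (n H) → Fin (n H) → List (Fin (n H)) → List (Fin (m H)) → Set where
  nil  : ∀ {v} → Walk H allowed v v (v ∷ []) []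
  cons : ∀ {u v w vs es} (e : Fin (m H)) → allowed e →
         u ∈ edge H e → v ∈ edge H e →
         Walk H allowed v w vs es → Walk H allowed u w (u ∷ vs) (e ∷ es)

BergePath : (H : Hypergraph) → (Fin (m H) → Set) → Fin (n H) → Fin (n H) → Set
BergePath H allowed u w =
  Σ (List (Fin (n H))) λ vs → Σ (List (Fin (m H))) λ es →
    Walk H allowed u w vs es × Unique vs × Unique es

EdgeConnected : ℕ → Hypergraph → Set
EdgeConnected λ' H =
  (D : Subset (m H)) → ∣ D ∣ ≤ λ' ∸ 1 →
  (u w : Fin (n H)) → BergePath H (λ e → e ∉ D) u w

record MultiGraph (n : ℕ) : Set where
  field
    p     : ℕ
    end₁  : Fin p → Fin n
    end₂  : Fin p → Fin n
    noLoop : ∀ i → end₁ i ≢ end₂ i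
open MultiGraph public

gdegree : ∀ {n} → MultiGraph n → Fin n → ℕ
gdegree G v = count (λ i → ⌊ end₁ G i ≟ v ⌋ ∨ ⌊ end₂ G i ≟ v ⌋)

GRegular : ∀ {n} → ℕ → MultiGraph n → Set
GRegular k G = ∀ v → gdegree G v ≡ k

-- Berge k-factor: a sub-multiset S of the edges (spanning subhypergraph),
-- a k-regular multigraph G on the same vertex set, and a bijection
-- φ : E(G) → S with each graph edge contained in its image.
BergeFactor : ℕ → Hypergraph → Set
BergeFactor k H =
  Σ (Subset (m H)) λ S → Σ (MultiGraph (n H)) λ G →
  Σ (Fin (p G) → Fin (m H)) λ φ →
    GRegular k G ×
    Injective _≡_ _≡_ φ ×
    (∀ i → φ i ∈ S) ×
    (∀ e → e ∈ S → ∃[ i ] φ i ≡ e) ×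
    (∀ i → end₁ G i ∈ edge H (φ i) × end₂ G i ∈ edge H (φ i))

-- Double counting gives n·r = m·t in an r-regular t-uniform hypergraph, while a Berge k-factor
-- injects a k-regular multigraph with n·k/2 edges into the hyperedges, so n·k ≤ 2m and hence
-- k·t ≤ 2r. What remains is to build r-edge-connected r-regular t-uniform hypergraphs on
-- arbitrarily many vertices.
--
-- Take K blocks of t vertices (slots) and K blocks of r edges. An edge of block j is either the
-- whole vertex block j, or block j with one of two distinguished slots β moved to slot β of block
-- j + 1 (mod K). For a fixed edge type and slot, the block map is a permutation, which gives
-- regularity. Deleting fewer than r edges leaves every block a live edge, joining its other slots
-- to a distinguished one, so only the distinguished slots need to be connected.
-- For r = 2a, every block has a whole-block edges and a edges shifted at slot 0, so slot 0 of
-- consecutive blocks forms a ring whose link from block j runs through slot 1 of block j. Fewer than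
-- 2a deletions kill at most one of these classes of a parallel edges, hence break at most one link,
-- and slot 1 stays attached through the surviving class of its block. For r = 2a + 1 and K even,
-- every block has one whole-block edge (a rung) and a edges shifted at each of the two slots; the
-- distinguished slots then form two rings alternating between slots 0 and 1. Breaking two links of
-- one ring uses up all 2a deletions, so the other ring and every rung survive; otherwise both rings
-- survive, and so does one of the K > 2a rungs.

module Submission where

open import Defs
open import Data.Nat using (ℕ; _*_; _≤_; _<_)
open import Data.Product using (Σ; _×_)
open import Relation.Nullary using (¬_)

open import Algebra.Properties.CommutativeMonoid.Sum as Sum using ()
open import Algebra.Properties.CommutativeSemigroup as CommSemigroupProperties using ()
open import Data.Bool using (Bool; true; false; _∨_; if_then_else_)
open import Data.Empty using (⊥; ⊥-elim)
open import Data.Fin as Fin using (Fin; zero; suc; toℕ; combine; _↑ˡ_; _↑ʳ_)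
import Data.Fin.Properties as Fin
open import Data.Fin.Properties using (suc-injective; injective⇒≤)
open import Data.Fin.Permutation as Perm using (Permutation; permutation; _⟨$⟩ʳ_; _⟨$⟩ˡ_; inverseˡ; inverseʳ)
open import Data.Fin.Subset using (Subset; _∈_; _∉_; ∣_∣; _-_)
open import Data.Fin.Subset.Properties using (_∈?_; x∈p∧x≢y⇒x∈p-y; x∈p⇒∣p-x∣<∣p∣)
open import Data.List using (drop)
import Data.List.Membership.Propositional as L
open import Data.List.Relation.Binary.Sublist.Propositional.Properties using (Any-resp-⊆; drop-⊆)
open import Data.List.Relation.Unary.All using ([]; _∷_)
open import Data.List.Relation.Unary.All.Properties using (¬Any⇒All¬; All¬⇒¬Any)
open import Data.List.Relation.Unary.AllPairs using ([]; _∷_)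
open import Data.List.Relation.Unary.Any using (here; there; any?)
open import Data.List.Relation.Unary.Unique.Propositional using (Unique)
open import Data.List.Relation.Unary.Unique.Propositional.Properties using (drop⁺)
open import Data.Nat
  using (zero; suc; _+_; z≤n; s≤s; s≤s⁻¹; _≤′_; ≤′-refl; ≤′-step; _≤?_; NonZero; >-nonZero)
open import Data.Nat.Base using (parity)
open import Data.Nat.DivMod using (_%_; _mod_; %-distribˡ-+; m%n%n≡m%n; m%n<n; m<n⇒m%n≡m; [m+n]%n≡m%n; n%n≡0)
open import Data.Nat.Properties hiding (suc-injective)
open import Data.Parity.Base using (Parity; 0ℙ; 1ℙ; _⁻¹) renaming (_+_ to _ℙ+_)
import Data.Parity.Properties as ℙ
open import Data.Parity.Properties using (⁻¹-selfInverse; suc-homo-⁻¹; +-homo-+)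
open import Data.Product using (∃; ∃₂; _,_; proj₁; proj₂)
open import Data.Sum using (_⊎_; inj₁; inj₂; [_,_]′)
open import Data.Vec using ([]; _∷_; lookup; tabulate)
open import Data.Vec.Properties using (lookup∘tabulate; lookup⇒[]=)
open import Function using (_∘_; const)
open import Function.Definitions using (Injective)
open import Level using (0ℓ)
open import Relation.Binary using (Setoid)
open import Relation.Binary.PropositionalEquality
open import Relation.Nullary using (Dec; yes; no; ¬?)
open import Relation.Nullary.Decidable using (⌊_⌋; decidable-stable; _×-dec_)
open import Relation.Unary using (Pred; Decidable)

open Sum +-0-commutativeMonoid using (sum-syntax; ∑-comm; ∑-distrib-+; sum-cong-≗)
open CommSemigroupProperties *-commutativeSemigroup using ()
  renaming (xy∙z≈y∙xz to *-xy∙z≈y∙xz; x∙yz≈y∙xz to *-x∙yz≈y∙xz)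

indicator : Bool → ℕ
indicator b = if b then 1 else 0

count≡∑ : ∀ {n} (f : Fin n → Bool) → count f ≡ ∑[ i < n ] indicator (f i)
count≡∑ {zero}  f = refl
count≡∑ {suc n} f = cong (indicator (f zero) +_) (count≡∑ (f ∘ suc))

count-cong : ∀ {n} {f g : Fin n → Bool} → (∀ i → f i ≡ g i) → count f ≡ count g
count-cong {zero}  f≗g = refl
count-cong {suc n} f≗g = cong₂ _+_ (cong indicator (f≗g zero)) (count-cong (f≗g ∘ suc))

∑-const : ∀ n c → ∑[ i < n ] c ≡ n * c
∑-const zero    c = refl
∑-const (suc n) c = cong (c +_) (∑-const n c)

∑-1 : ∀ n → ∑[ i < n ] 1 ≡ n
∑-1 n = trans (∑-const n 1) (*-identityʳ n)

∑-↑ : ∀ m {n} (f : Fin (m + n) → ℕ) →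
      ∑[ x < m + n ] f x ≡ ∑[ i < m ] f (i ↑ˡ n) + ∑[ j < n ] f (m ↑ʳ j)
∑-↑ zero    f = refl
∑-↑ (suc m) f = trans (cong (f zero +_) (∑-↑ m (f ∘ suc))) (sym (+-assoc (f zero) _ _))

∑-combine : ∀ m {n} (f : Fin (m * n) → ℕ) →
            ∑[ x < m * n ] f x ≡ ∑[ i < m ] ∑[ j < n ] f (combine i j)
∑-combine zero    f = refl
∑-combine (suc m) {n} f =
  trans (∑-↑ n f) (cong (∑[ j < n ] f (j ↑ˡ (m * n)) +_) (∑-combine m (f ∘ (n ↑ʳ_))))

count-remQuot : ∀ k {l} (f : Fin k × Fin l → Bool) →
                count (λ x → f (Fin.remQuot l x)) ≡ ∑[ j < l ] count (λ i → f (i , j))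
count-remQuot k {l} f = begin
  count (λ x → f (Fin.remQuot l x))               ≡⟨ count≡∑ (λ x → f (Fin.remQuot l x)) ⟩
  ∑[ x < k * l ] indicator (f (Fin.remQuot l x))  ≡⟨ ∑-combine k (λ x → indicator (f (Fin.remQuot l x))) ⟩
  ∑[ i < k ] ∑[ j < l ] indicator (f (Fin.remQuot l (combine i j)))
    ≡⟨ sum-cong-≗ (λ i → sum-cong-≗ (λ j → cong (indicator ∘ f) (Fin.remQuot-combine i j))) ⟩
  ∑[ i < k ] ∑[ j < l ] indicator (f (i , j))     ≡⟨ ∑-comm (λ i j → indicator (f (i , j))) ⟩
  ∑[ j < l ] ∑[ i < k ] indicator (f (i , j))
    ≡⟨ sym (sum-cong-≗ (λ j → count≡∑ (λ i → f (i , j)))) ⟩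
  ∑[ j < l ] count (λ i → f (i , j))              ∎
  where open ≡-Reasoning

count-none : ∀ {p n} {P : Pred (Fin n) p} (P? : Decidable P) →
             (∀ i → ¬ P i) → count (λ i → ⌊ P? i ⌋) ≡ 0
count-none {n = zero}  P? ¬P = refl
count-none {n = suc n} P? ¬P with P? zero
... | yes P0 = ⊥-elim (¬P zero P0)
... | no  _  = count-none (P? ∘ suc) (¬P ∘ suc)

count-unique : ∀ {p n} {P : Pred (Fin n) p} (P? : Decidable P) {c : Fin n} →
               P c → (∀ {i} → P i → i ≡ c) → count (λ i → ⌊ P? i ⌋) ≡ 1
count-unique {n = suc n} P? {zero} Pc unique with P? zero
... | yes _  = cong suc (count-none (P? ∘ suc) (λ i → 0≢1+n ∘ sym ∘ cong toℕ ∘ unique))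
... | no ¬P0 = ⊥-elim (¬P0 Pc)
count-unique {n = suc n} P? {suc c} Pc unique with P? zero
... | yes P0 = ⊥-elim (0≢1+n (cong toℕ (unique P0)))
... | no  _  = count-unique (P? ∘ suc) Pc (suc-injective ∘ unique)

∣p∣≡count : ∀ {n} (p : Subset n) → ∣ p ∣ ≡ count (lookup p)
∣p∣≡count []          = refl
∣p∣≡count (true  ∷ p) = cong suc (∣p∣≡count p)
∣p∣≡count (false ∷ p) = ∣p∣≡count p

∣tabulate∣≡count : ∀ {n} (f : Fin n → Bool) → ∣ tabulate f ∣ ≡ count f
∣tabulate∣≡count f = trans (∣p∣≡count (tabulate f)) (count-cong (lookup∘tabulate f))

injective⇒≤∣∣ : ∀ {k n} {p : Subset n} (f : Fin k → Fin n) → Injective _≡_ _≡_ f →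
                (∀ i → f i ∈ p) → k ≤ ∣ p ∣
injective⇒≤∣∣ {zero}          f f-inj f∈p = z≤n
injective⇒≤∣∣ {suc k} {p = p} f f-inj f∈p =
  ≤-trans (s≤s (injective⇒≤∣∣ (f ∘ suc) (suc-injective ∘ f-inj) f∘suc∈p-f0))
          (x∈p⇒∣p-x∣<∣p∣ (f∈p zero))
  where
  f∘suc∈p-f0 : ∀ i → f (suc i) ∈ p - f zero
  f∘suc∈p-f0 i = x∈p∧x≢y⇒x∈p-y (f∈p (suc i)) (λ eq → 0≢1+n (cong toℕ (sym (f-inj eq))))

disjoint-injective⇒+≤∣∣ : ∀ {k l n} {p : Subset n} (f : Fin k → Fin n) (g : Fin l → Fin n) →
                          Injective _≡_ _≡_ f → Injective _≡_ _≡_ g → (∀ i j → f i ≢ g j) →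
                          (∀ i → f i ∈ p) → (∀ j → g j ∈ p) → k + l ≤ ∣ p ∣
disjoint-injective⇒+≤∣∣ {zero}          f g f-inj g-inj f≢g f∈p g∈p = injective⇒≤∣∣ g g-inj g∈p
disjoint-injective⇒+≤∣∣ {suc k} {p = p} f g f-inj g-inj f≢g f∈p g∈p =
  ≤-trans (s≤s (disjoint-injective⇒+≤∣∣ (f ∘ suc) g (suc-injective ∘ f-inj) g-inj (f≢g ∘ suc)
                  (λ i → x∈p∧x≢y⇒x∈p-y (f∈p (suc i)) (λ eq → 0≢1+n (cong toℕ (sym (f-inj eq)))))
                  (λ j → x∈p∧x≢y⇒x∈p-y (g∈p j) (≢-sym (f≢g zero j)))))
          (x∈p⇒∣p-x∣<∣p∣ (f∈p zero))

injective⇒∃∉ : ∀ {k n} {p : Subset n} (f : Fin k → Fin n) → Injective _≡_ _≡_ f →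
               ∣ p ∣ < k → ∃ λ i → f i ∉ p
injective⇒∃∉ {p = p} f f-inj ∣p∣<k with Fin.any? (λ i → ¬? (f i ∈? p))
... | yes found = found
... | no  none  = ⊥-elim (<⇒≱ ∣p∣<k (injective⇒≤∣∣ f f-inj f∈p))
  where
  f∈p : ∀ i → f i ∈ p
  f∈p i = decidable-stable (f i ∈? p) (λ f∉p → none (i , f∉p))

allButOne⊎twoFail : ∀ {p n} {P : Pred (Fin (suc n)) p} → Decidable P →
                    (∃ λ d → ∀ i → i ≢ d → P i) ⊎ (∃₂ λ i j → i ≢ j × ¬ P i × ¬ P j)
allButOne⊎twoFail P? with Fin.any? (λ i → ¬? (P? i))
... | no noFailure = inj₁ (zero , λ i _ → decidable-stable (P? i) (λ ¬Pi → noFailure (i , ¬Pi)))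
... | yes (d , ¬Pd) with Fin.any? (λ i → ¬? (i Fin.≟ d) ×-dec ¬? (P? i))
...   | yes (i , i≢d , ¬Pi) = inj₂ (i , d , i≢d , ¬Pi , ¬Pd)
...   | no  noOther         =
        inj₁ (d , λ i i≢d → decidable-stable (P? i) (λ ¬Pi → noOther (i , i≢d , ¬Pi)))

⌊≟⌋-true : ∀ {n} {x y : Fin n} → x ≡ y → ⌊ x Fin.≟ y ⌋ ≡ true
⌊≟⌋-true {x = x} {y} x≡y with x Fin.≟ y
... | yes _   = refl
... | no x≢y = ⊥-elim (x≢y x≡y)

count-≟ : ∀ {n} (x : Fin n) → count (λ v → ⌊ x Fin.≟ v ⌋) ≡ 1
count-≟ x = count-unique (x Fin.≟_) refl sym

count-preimage : ∀ {n} (π : Permutation n n) y → count (λ x → ⌊ π ⟨$⟩ʳ x Fin.≟ y ⌋) ≡ 1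
count-preimage π y =
  count-unique (λ x → π ⟨$⟩ʳ x Fin.≟ y) (inverseʳ π)
               (λ πx≡y → trans (sym (inverseˡ π)) (cong (π ⟨$⟩ˡ_) πx≡y))

indicator-∨ : ∀ {n} {x y : Fin n} → x ≢ y → ∀ v →
              indicator (⌊ x Fin.≟ v ⌋ ∨ ⌊ y Fin.≟ v ⌋) ≡
              indicator ⌊ x Fin.≟ v ⌋ + indicator ⌊ y Fin.≟ v ⌋
indicator-∨ {x = x} {y} x≢y v with x Fin.≟ v | y Fin.≟ v
... | yes x≡v | yes y≡v = ⊥-elim (x≢y (trans x≡v (sym y≡v)))
... | yes _   | no  _   = refl
... | no  _   | yes _   = refl
... | no  _   | no  _   = refl

∑-indicator-∨ : ∀ {n} {x y : Fin n} → x ≢ y →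
                ∑[ v < n ] indicator (⌊ x Fin.≟ v ⌋ ∨ ⌊ y Fin.≟ v ⌋) ≡ 2
∑-indicator-∨ {n} {x} {y} x≢y = begin
  ∑[ v < n ] indicator (⌊ x Fin.≟ v ⌋ ∨ ⌊ y Fin.≟ v ⌋)
    ≡⟨ sum-cong-≗ (indicator-∨ x≢y) ⟩
  ∑[ v < n ] (indicator ⌊ x Fin.≟ v ⌋ + indicator ⌊ y Fin.≟ v ⌋)
    ≡⟨ ∑-distrib-+ (λ v → indicator ⌊ x Fin.≟ v ⌋) (λ v → indicator ⌊ y Fin.≟ v ⌋) ⟩
  ∑[ v < n ] indicator ⌊ x Fin.≟ v ⌋ + ∑[ v < n ] indicator ⌊ y Fin.≟ v ⌋
    ≡⟨ sym (cong₂ _+_ (count≡∑ (λ v → ⌊ x Fin.≟ v ⌋)) (count≡∑ (λ v → ⌊ y Fin.≟ v ⌋))) ⟩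
  count (λ v → ⌊ x Fin.≟ v ⌋) + count (λ v → ⌊ y Fin.≟ v ⌋)
    ≡⟨ cong₂ _+_ (count-≟ x) (count-≟ y) ⟩
  2 ∎
  where open ≡-Reasoning

handshake : ∀ {n} (G : MultiGraph n) → ∑[ v < n ] gdegree G v ≡ p G * 2
handshake {n} G = begin
  ∑[ v < n ] gdegree G v                       ≡⟨ sum-cong-≗ (λ v → count≡∑ (λ i → ends i v)) ⟩
  ∑[ v < n ] ∑[ i < p G ] indicator (ends i v) ≡⟨ ∑-comm (λ v i → indicator (ends i v)) ⟩
  ∑[ i < p G ] ∑[ v < n ] indicator (ends i v) ≡⟨ sum-cong-≗ (λ i → ∑-indicator-∨ (noLoop G i)) ⟩
  ∑[ i < p G ] 2                               ≡⟨ ∑-const (p G) 2 ⟩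
  p G * 2                                      ∎
  where
  open ≡-Reasoning
  ends : Fin (p G) → Fin n → Bool
  ends i v = ⌊ end₁ G i Fin.≟ v ⌋ ∨ ⌊ end₂ G i Fin.≟ v ⌋

∑degree≡∑∣edge∣ : (H : Hypergraph) → ∑[ v < n H ] degree H v ≡ ∑[ e < m H ] ∣ edge H e ∣
∑degree≡∑∣edge∣ H = begin
  ∑[ v < n H ] degree H v                                   ≡⟨ sum-cong-≗ (λ v → count≡∑ (λ e → contains e v)) ⟩
  ∑[ v < n H ] ∑[ e < m H ] indicator (lookup (edge H e) v) ≡⟨ ∑-comm (λ v e → indicator (contains e v)) ⟩
  ∑[ e < m H ] ∑[ v < n H ] indicator (lookup (edge H e) v) ≡⟨ sum-cong-≗ size ⟩
  ∑[ e < m H ] ∣ edge H e ∣                                 ∎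
  where
  open ≡-Reasoning
  contains : Fin (m H) → Fin (n H) → Bool
  contains e v = lookup (edge H e) v
  size : ∀ e → ∑[ v < n H ] indicator (contains e v) ≡ ∣ edge H e ∣
  size e = sym (trans (∣p∣≡count (edge H e)) (count≡∑ (contains e)))

regular∧uniform⇒¬BergeFactor : ∀ {r t k} (H : Hypergraph) → Regular r H → Uniform t H →
                               0 < n H → 2 * r < k * t → ¬ BergeFactor k H
regular∧uniform⇒¬BergeFactor {r} {t} {k} H regular uniform 0<n 2r<kt (_ , G , φ , G-regular , φ-inj , _) =
  <⇒≱ 2r<kt (*-cancelˡ-≤ (n H) {{>-nonZero 0<n}} nkt≤n2r)
  where
  open ≤-Reasoning
  nk≡2p : n H * k ≡ p G * 2
  nk≡2p = trans (sym (∑-const (n H) k)) (trans (sum-cong-≗ (sym ∘ G-regular)) (handshake G))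
  nr≡mt : n H * r ≡ m H * t
  nr≡mt = begin-equality
    n H * r                   ≡⟨ sym (∑-const (n H) r) ⟩
    ∑[ v < n H ] r            ≡⟨ sum-cong-≗ (sym ∘ regular) ⟩
    ∑[ v < n H ] degree H v   ≡⟨ ∑degree≡∑∣edge∣ H ⟩
    ∑[ e < m H ] ∣ edge H e ∣ ≡⟨ sum-cong-≗ uniform ⟩
    ∑[ e < m H ] t            ≡⟨ ∑-const (m H) t ⟩
    m H * t                   ∎
  nkt≤n2r : n H * (k * t) ≤ n H * (2 * r)
  nkt≤n2r = begin
    n H * (k * t) ≡⟨ sym (*-assoc (n H) k t) ⟩
    n H * k * t   ≡⟨ cong (_* t) nk≡2p ⟩
    p G * 2 * t   ≤⟨ *-monoˡ-≤ t (*-monoˡ-≤ 2 (injective⇒≤ φ-inj)) ⟩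
    m H * 2 * t   ≡⟨ *-xy∙z≈y∙xz (m H) 2 t ⟩
    2 * (m H * t) ≡⟨ cong (2 *_) (sym nr≡mt) ⟩
    2 * (n H * r) ≡⟨ *-x∙yz≈y∙xz 2 (n H) r ⟩
    n H * (2 * r) ∎

fromIncidence : ∀ {k l} (incident : Fin l → Fin k → Bool) → (∀ e → 2 ≤ count (incident e)) → Hypergraph
fromIncidence {k} {l} incident 2≤∣e∣ = record
  { n      = k
  ; m      = l
  ; edge   = λ e → tabulate (incident e)
  ; edge≥2 = λ e → subst (2 ≤_) (sym (∣tabulate∣≡count (incident e))) (2≤∣e∣ e)
  }

module _ (H : Hypergraph) (allowed : Fin (m H) → Set) where

  Reachable : Fin (n H) → Fin (n H) → Set
  Reachable u w = ∃₂ λ vs es → Walk H allowed u w vs es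

  walk-++ : ∀ {u v w vs es} → Walk H allowed u v vs es → Reachable v w → Reachable u w
  walk-++ nil                    q = q
  walk-++ (cons e ok u∈e v∈e p) q with walk-++ p q
  ... | _ , _ , pq = _ , _ , cons e ok u∈e v∈e pq

  edge⇒reachable : ∀ {u v} e → allowed e → u ∈ edge H e → v ∈ edge H e → Reachable u v
  edge⇒reachable e ok u∈e v∈e = _ , _ , cons e ok u∈e v∈e nil

  reachable-trans : ∀ {u v w} → Reachable u v → Reachable v w → Reachable u w
  reachable-trans (_ , _ , p) = walk-++ p

  walk-reverse : ∀ {u w vs es} → Walk H allowed u w vs es → Reachable w u
  walk-reverse nil                    = _ , _ , nil
  walk-reverse (cons e ok u∈e v∈e p) = reachable-trans (walk-reverse p) (edge⇒reachable e ok v∈e u∈e)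

  reachable-setoid : Setoid 0ℓ 0ℓ
  reachable-setoid = record
    { Carrier       = Fin (n H)
    ; _≈_           = Reachable
    ; isEquivalence = record
      { refl  = _ , _ , nil
      ; sym   = λ (_ , _ , p) → walk-reverse p
      ; trans = reachable-trans
      }
    }

  suffix-from-vertex : ∀ {u w x vs es} → Walk H allowed u w vs es → x L.∈ vs →
                       ∃ λ k → Walk H allowed x w (drop k vs) (drop k es)
  suffix-from-vertex nil                (here refl)  = 0 , nil
  suffix-from-vertex p@(cons _ _ _ _ _) (here refl)  = 0 , p
  suffix-from-vertex (cons _ _ _ _ p)   (there x∈vs) with suffix-from-vertex p x∈vs
  ... | k , q = suc k , q

  suffix-after-edge : ∀ {u w e vs es} → Walk H allowed u w vs es → Unique es → e L.∈ es →
                      ∃₂ λ k x → x ∈ edge H e × Walk H allowed x w (drop k vs) (drop k es) ×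
                                 ¬ e L.∈ drop k es
  suffix-after-edge (cons _ _ _ v∈e p) (e∉es ∷ _) (here refl)  = 1 , _ , v∈e , p , All¬⇒¬Any e∉es
  suffix-after-edge (cons _ _ _ _ p)   (_ ∷ es!)   (there e∈es) with suffix-after-edge p es! e∈es
  ... | k , x , x∈e , q , e∉ = suc k , x , x∈e , q , e∉

  prepend : ∀ {u v w} e → allowed e → u ∈ edge H e → v ∈ edge H e →
            BergePath H allowed v w → BergePath H allowed u w
  prepend {u} e ok u∈e v∈e (vs , es , p , vs! , es!) with any? (u Fin.≟_) vs
  ... | yes u∈vs with suffix-from-vertex p u∈vs
  ...   | k , q = _ , _ , q , drop⁺ k vs! , drop⁺ k es!
  prepend {u} e ok u∈e v∈e (vs , es , p , vs! , es!) | no u∉vs with any? (e Fin.≟_) es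
  ... | no e∉es = _ , _ , cons e ok u∈e v∈e p , ¬Any⇒All¬ vs u∉vs ∷ vs! , ¬Any⇒All¬ es e∉es ∷ es!
  ... | yes e∈es with suffix-after-edge p es! e∈es
  ...   | k , x , x∈e , q , e∉ =
          _ , _ , cons e ok u∈e x∈e q ,
          ¬Any⇒All¬ _ (u∉vs ∘ Any-resp-⊆ (drop-⊆ k vs)) ∷ drop⁺ k vs! ,
          ¬Any⇒All¬ _ e∉ ∷ drop⁺ k es!

  walk⇒path : ∀ {u w vs es} → Walk H allowed u w vs es → BergePath H allowed u w
  walk⇒path nil                    = _ , _ , nil , [] ∷ [] , []
  walk⇒path (cons e ok u∈e v∈e p) = prepend e ok u∈e v∈e (walk⇒path p)

reachable⇒edgeConnected : ∀ {k} (H : Hypergraph) →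
                          (∀ D → ∣ D ∣ < suc k → ∀ u w → Reachable H (_∉ D) u w) →
                          EdgeConnected (suc k) H
reachable⇒edgeConnected H connected D ∣D∣≤k u w with connected D (s≤s ∣D∣≤k) u w
... | _ , _ , p = walk⇒path H _ p

[m+n%d]%d≡[m+n]%d : ∀ m n d .{{_ : NonZero d}} → (m + n % d) % d ≡ (m + n) % d
[m+n%d]%d≡[m+n]%d m n d = begin
  (m + n % d) % d         ≡⟨ %-distribˡ-+ m (n % d) d ⟩
  (m % d + n % d % d) % d ≡⟨ cong (λ x → (m % d + x) % d) (m%n%n≡m%n n d) ⟩
  (m % d + n % d) % d     ≡⟨ sym (%-distribˡ-+ m n d) ⟩
  (m + n) % d             ∎
  where open ≡-Reasoning

toℕ-mod : ∀ p n .{{_ : NonZero n}} → toℕ (p mod n) ≡ p % n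
toℕ-mod p n = Fin.toℕ-fromℕ< (m%n<n p n)

mod-cong : ∀ p q n .{{_ : NonZero n}} → p % n ≡ q % n → p mod n ≡ q mod n
mod-cong p q n eq = Fin.toℕ-injective (trans (toℕ-mod p n) (trans eq (sym (toℕ-mod q n))))

toℕ-mod< : ∀ {p n} .{{_ : NonZero n}} → p < n → toℕ (p mod n) ≡ p
toℕ-mod< {p} {n} p<n = trans (toℕ-mod p n) (m<n⇒m%n≡m p<n)

toℕ-mod-id : ∀ {n} (i : Fin (suc n)) → toℕ i mod suc n ≡ i
toℕ-mod-id i = Fin.toℕ-injective (toℕ-mod< (Fin.toℕ<n i))

next : ∀ {n} → Fin (suc n) → Fin (suc n)
next {n} i = suc (toℕ i) mod suc n

prev : ∀ {n} → Fin (suc n) → Fin (suc n)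
prev {n} i = (n + toℕ i) mod suc n

next-mod : ∀ {n} p → next (p mod suc n) ≡ suc p mod suc n
next-mod {n} p = mod-cong (suc (toℕ (p mod suc n))) (suc p) (suc n) (begin
  suc (toℕ (p mod suc n)) % suc n ≡⟨ cong (λ x → suc x % suc n) (toℕ-mod p (suc n)) ⟩
  (1 + p % suc n) % suc n         ≡⟨ [m+n%d]%d≡[m+n]%d 1 p (suc n) ⟩
  suc p % suc n                   ∎)
  where open ≡-Reasoning

[1+n+i]mod[1+n]≡i : ∀ {n} (i : Fin (suc n)) → (suc n + toℕ i) mod suc n ≡ i
[1+n+i]mod[1+n]≡i {n} i = trans (mod-cong (suc n + toℕ i) (toℕ i) (suc n) n+i%n≡i%n) (toℕ-mod-id i)
  where
  n+i%n≡i%n : (suc n + toℕ i) % suc n ≡ toℕ i % suc n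
  n+i%n≡i%n = trans (cong (_% suc n) (+-comm (suc n) (toℕ i))) ([m+n]%n≡m%n (toℕ i) (suc n))

next-prev : ∀ {n} (i : Fin (suc n)) → next (prev i) ≡ i
next-prev {n} i = trans (next-mod (n + toℕ i)) ([1+n+i]mod[1+n]≡i i)

prev-next : ∀ {n} (i : Fin (suc n)) → prev (next i) ≡ i
prev-next {n} i = trans (mod-cong (n + toℕ (next i)) (suc n + toℕ i) (suc n) n+next%n) ([1+n+i]mod[1+n]≡i i)
  where
  open ≡-Reasoning
  n+next%n : (n + toℕ (next i)) % suc n ≡ (suc n + toℕ i) % suc n
  n+next%n = begin
    (n + toℕ (next i)) % suc n         ≡⟨ cong (λ x → (n + x) % suc n) (toℕ-mod (suc (toℕ i)) (suc n)) ⟩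
    (n + suc (toℕ i) % suc n) % suc n  ≡⟨ [m+n%d]%d≡[m+n]%d n (suc (toℕ i)) (suc n) ⟩
    (n + suc (toℕ i)) % suc n          ≡⟨ cong (_% suc n) (+-suc n (toℕ i)) ⟩
    (suc n + toℕ i) % suc n            ∎

rotation : ∀ {n} → Permutation (suc n) (suc n)
rotation = permutation next prev next-prev prev-next

parity-suc : ∀ p → parity (suc p) ≡ parity p ⁻¹
parity-suc p = sym (⁻¹-selfInverse (suc-homo-⁻¹ p))

parity-next : ∀ {n} → parity (suc n) ≡ 0ℙ → (i : Fin (suc n)) →
              parity (toℕ (next i)) ≡ parity (toℕ i) ⁻¹
parity-next {n} even i with m≤n⇒m<n∨m≡n (Fin.toℕ≤pred[n] i)
... | inj₁ i<n = trans (cong parity (toℕ-mod< {suc (toℕ i)} (s≤s i<n))) (parity-suc (toℕ i))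
... | inj₂ i≡n = begin
  parity (toℕ (next i))  ≡⟨ cong parity (toℕ-mod (suc (toℕ i)) (suc n)) ⟩
  parity (suc (toℕ i) % suc n) ≡⟨ cong (λ x → parity (suc x % suc n)) i≡n ⟩
  parity (suc n % suc n) ≡⟨ cong parity (n%n≡0 (suc n)) ⟩
  0ℙ                     ≡⟨ sym even ⟩
  parity (suc n)         ≡⟨ parity-suc n ⟩
  parity n ⁻¹            ≡⟨ cong (λ x → parity x ⁻¹) (sym i≡n) ⟩
  parity (toℕ i) ⁻¹      ∎
  where open ≡-Reasoning

module _ {c ℓ} (S : Setoid c ℓ) where
  private module S = Setoid S

  chain : (w : ℕ → S.Carrier) {i j : ℕ} → i ≤′ j →
          (∀ g → i ≤ g → g < j → w g S.≈ w (suc g)) → w i S.≈ w j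
  chain w ≤′-refl         links = S.refl
  chain w (≤′-step i≤′j) links =
    S.trans (chain w i≤′j (λ g i≤g g<j → links g i≤g (m<n⇒m<1+n g<j)))
            (links _ (≤′⇒≤ i≤′j) ≤-refl)

  ring-connected : ∀ {n} (W : Fin (suc n) → S.Carrier) (d : Fin (suc n)) →
                   (∀ i → i ≢ d → W i S.≈ W (next i)) → ∀ i → W zero S.≈ W i
  ring-connected {n} W d links i = S.trans (along (toℕ i ≤? toℕ d)) (S.reflexive (cong W (toℕ-mod-id i)))
    where
    w : ℕ → S.Carrier
    w p = W (p mod suc n)
    link : ∀ g → g < suc n → g ≢ toℕ d → w g S.≈ w (suc g)
    link g g<n g≢d = S.trans (links (g mod suc n) (λ g≡d → g≢d (trans (sym (toℕ-mod< g<n)) (cong toℕ g≡d))))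
                             (S.reflexive (cong W (next-mod g)))
    -- Walk up from 0 to i if the broken link d is not below i, and otherwise up from i
    -- through the wrap-around at suc n.
    along : Dec (toℕ i ≤ toℕ d) → w 0 S.≈ w (toℕ i)
    along (yes i≤d) = chain w (≤⇒≤′ z≤n)
      (λ g _ g<i → link g (<-trans g<i (Fin.toℕ<n i)) (<⇒≢ (<-≤-trans g<i i≤d)))
    along (no  i≰d) = S.sym (S.trans (chain w (≤⇒≤′ (<⇒≤ (Fin.toℕ<n i)))
      (λ g i≤g g<n → link g g<n (>⇒≢ (<-≤-trans (≰⇒> i≰d) i≤g))))
      (S.reflexive (cong W (mod-cong (suc n) 0 (suc n) (n%n≡0 (suc n))))))

module Halves (a : ℕ) where

  half : Parity → Fin a → Fin (a + a)
  half 0ℙ i = i ↑ˡ a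
  half 1ℙ i = a ↑ʳ i

  side : Fin (a + a) → Parity
  side q = [ const 0ℙ , const 1ℙ ]′ (Fin.splitAt a q)

  side-half : ∀ β i → side (half β i) ≡ β
  side-half 0ℙ i = cong [ const 0ℙ , const 1ℙ ]′ (Fin.splitAt-↑ˡ a i a)
  side-half 1ℙ i = cong [ const 0ℙ , const 1ℙ ]′ (Fin.splitAt-↑ʳ a a i)

  half-injective : ∀ {β β′ i i′} → half β i ≡ half β′ i′ → β ≡ β′ × i ≡ i′
  half-injective {0ℙ} {0ℙ} {i} {i′} eq = refl , Fin.↑ˡ-injective a i i′ eq
  half-injective {1ℙ} {1ℙ} {i} {i′} eq = refl , Fin.↑ʳ-injective a i i′ eq
  half-injective {0ℙ} {1ℙ} {i} {i′} eq
    with trans (sym (side-half 0ℙ i)) (trans (cong side eq) (side-half 1ℙ i′))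
  ... | ()
  half-injective {1ℙ} {0ℙ} {i} {i′} eq
    with trans (sym (side-half 1ℙ i)) (trans (cong side eq) (side-half 0ℙ i′))
  ... | ()

data EdgeType : Set where
  block   : EdgeType
  shifted : Parity → EdgeType

module Construction (K′ t′ r : ℕ) (type : Fin r → EdgeType) where

  K t : ℕ
  K = suc K′
  t = suc (suc t′)

  slot : Parity → Fin t
  slot 0ℙ = zero
  slot 1ℙ = suc zero

  move : EdgeType → Fin t → Permutation K K
  move block       s = Perm.id
  move (shifted β) s = if ⌊ s Fin.≟ slot β ⌋ then rotation else Perm.id

  vertex : Fin K → Fin t → Fin (K * t)
  vertex = combine

  edgeAt : Fin K → Fin r → Fin (K * r)
  edgeAt = combine

  meets : Fin K × Fin r → Fin K × Fin t → Bool
  meets (j , q) (j′ , s) = ⌊ move (type q) s ⟨$⟩ʳ j Fin.≟ j′ ⌋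

  incident : Fin (K * r) → Fin (K * t) → Bool
  incident e v = meets (Fin.remQuot {K} r e) (Fin.remQuot {K} t v)

  incident-size : ∀ e → count (incident e) ≡ t
  incident-size e = trans (count-remQuot K (meets (Fin.remQuot {K} r e)))
                 (trans (sum-cong-≗ (λ s → count-≟ (move (type q) s ⟨$⟩ʳ j))) (∑-1 t))
    where
    j = proj₁ (Fin.remQuot {K} r e)
    q = proj₂ (Fin.remQuot {K} r e)

  incident-degree : ∀ v → count (λ e → incident e v) ≡ r
  incident-degree v = trans (count-remQuot K (λ e → meets e (Fin.remQuot {K} t v)))
                            (trans (sum-cong-≗ (λ q → count-preimage (move (type q) s) j′)) (∑-1 r))
    where
    j′ = proj₁ (Fin.remQuot {K} t v)
    s  = proj₂ (Fin.remQuot {K} t v)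

  H : Hypergraph
  H = fromIncidence incident (λ e → subst (2 ≤_) (sym (incident-size e)) (s≤s (s≤s z≤n)))

  H-uniform : Uniform t H
  H-uniform e = trans (∣tabulate∣≡count (incident e)) (incident-size e)

  H-regular : Regular r H
  H-regular v = trans (count-cong (λ e → lookup∘tabulate (incident e) v)) (incident-degree v)

  ∈-edgeAt : ∀ {j q j′ s} → move (type q) s ⟨$⟩ʳ j ≡ j′ → vertex j′ s ∈ edge H (edgeAt j q)
  ∈-edgeAt {j} {q} {j′} {s} moves = lookup⇒[]= (vertex j′ s) (edge H (edgeAt j q)) (begin
    lookup (tabulate (incident (edgeAt j q))) (vertex j′ s)
      ≡⟨ lookup∘tabulate (incident (edgeAt j q)) (vertex j′ s) ⟩
    incident (edgeAt j q) (vertex j′ s)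
      ≡⟨ cong₂ meets (Fin.remQuot-combine j q) (Fin.remQuot-combine j′ s) ⟩
    meets (j , q) (j′ , s)
      ≡⟨ ⌊≟⌋-true moves ⟩
    true ∎)
    where open ≡-Reasoning

  shifted-self : ∀ β j → move (shifted β) (slot β) ⟨$⟩ʳ j ≡ next j
  shifted-self 0ℙ j = refl
  shifted-self 1ℙ j = refl

  shifted-other : ∀ b j → move (shifted (b ⁻¹)) (slot b) ⟨$⟩ʳ j ≡ j
  shifted-other 0ℙ j = refl
  shifted-other 1ℙ j = refl

  extra-fixed : ∀ τ s j → move τ (suc (suc s)) ⟨$⟩ʳ j ≡ j
  extra-fixed block        s j = refl
  extra-fixed (shifted 0ℙ) s j = refl
  extra-fixed (shifted 1ℙ) s j = refl

  anchor : EdgeType → Parity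
  anchor block       = 0ℙ
  anchor (shifted β) = β ⁻¹

  anchor-fixed : ∀ τ j → move τ (slot (anchor τ)) ⟨$⟩ʳ j ≡ j
  anchor-fixed block        j = refl
  anchor-fixed (shifted 0ℙ) j = refl
  anchor-fixed (shifted 1ℙ) j = refl

  module Deletion (D : Subset (K * r)) (∣D∣<r : ∣ D ∣ < r) where

    ~-setoid : Setoid 0ℓ 0ℓ
    ~-setoid = reachable-setoid H (_∉ D)

    open Setoid ~-setoid public using () renaming (_≈_ to _~_; refl to ~-refl; sym to ~-sym; trans to ~-trans)

    live-edge~ : ∀ j q {j₁ s₁ j₂ s₂} → edgeAt j q ∉ D →
                 move (type q) s₁ ⟨$⟩ʳ j ≡ j₁ → move (type q) s₂ ⟨$⟩ʳ j ≡ j₂ →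
                 vertex j₁ s₁ ~ vertex j₂ s₂
    live-edge~ j q live moves₁ moves₂ =
      edge⇒reachable H (_∉ D) (edgeAt j q) live (∈-edgeAt moves₁) (∈-edgeAt moves₂)

    within-block~ : ∀ j q → type q ≡ block → edgeAt j q ∉ D → ∀ s s′ → vertex j s ~ vertex j s′
    within-block~ j q type≡block live s s′ = live-edge~ j q live (fixed s) (fixed s′)
      where
      fixed : ∀ s → move (type q) s ⟨$⟩ʳ j ≡ j
      fixed s = cong (λ τ → move τ s ⟨$⟩ʳ j) type≡block

    across~ : ∀ j q b → type q ≡ shifted (b ⁻¹) → edgeAt j q ∉ D →
              vertex j (slot b) ~ vertex (next j) (slot (b ⁻¹))
    across~ j q b type≡shifted live = live-edge~ j q live
      (trans (cong (λ τ → move τ (slot b) ⟨$⟩ʳ j) type≡shifted) (shifted-other b j))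
      (trans (cong (λ τ → move τ (slot (b ⁻¹)) ⟨$⟩ʳ j) type≡shifted) (shifted-self (b ⁻¹) j))

    some-live-edge : ∀ j → ∃ λ q → edgeAt j q ∉ D
    some-live-edge j = injective⇒∃∉ (edgeAt j) (λ eq → proj₂ (Fin.combine-injective j _ j _ eq)) ∣D∣<r

    anchored-slots⇒anchored : ∀ {x} → (∀ j β → vertex j (slot β) ~ x) → ∀ v → v ~ x
    anchored-slots⇒anchored {x} slot~x v =
      subst (_~ x) (Fin.combine-remQuot {K} t v) (reach (proj₁ (Fin.remQuot {K} t v)) (proj₂ (Fin.remQuot {K} t v)))
      where
      via : ∀ j s → (∃ λ q → edgeAt j q ∉ D) → vertex j (suc (suc s)) ~ x
      via j s (q , live) = ~-trans (live-edge~ j q live (extra-fixed (type q) s j) (anchor-fixed (type q) j))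
                                   (slot~x j (anchor (type q)))
      reach : ∀ j s → vertex j s ~ x
      reach j zero          = slot~x j 0ℙ
      reach j (suc zero)    = slot~x j 1ℙ
      reach j (suc (suc s)) = via j s (some-live-edge j)

    anchored-slots⇒connected : ∀ {x} → (∀ j β → vertex j (slot β) ~ x) → ∀ u v → u ~ v
    anchored-slots⇒connected slot~x u v =
      ~-trans (anchored-slots⇒anchored slot~x u) (~-sym (anchored-slots⇒anchored slot~x v))

  module Classes (a : ℕ) (classSlot : Parity → Fin a → Fin r)
    (classSlot-injective : ∀ {β β′ i i′} → classSlot β i ≡ classSlot β′ i′ → β ≡ β′ × i ≡ i′)
    (D : Subset (K * r)) where

    class : Fin K → Parity → Fin a → Fin (K * r)
    class j β i = edgeAt j (classSlot β i)

    class-injective : ∀ j β i j′ β′ i′ → class j β i ≡ class j′ β′ i′ →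
                      (j , β) ≡ (j′ , β′) × i ≡ i′
    class-injective j β i j′ β′ i′ eq with Fin.combine-injective j (classSlot β i) j′ (classSlot β′ i′) eq
    ... | refl , slot≡ with classSlot-injective slot≡
    ...   | refl , refl = refl , refl

    classes-≤∣∣ : ∀ {j β j′ β′} {p : Subset (K * r)} → (j , β) ≢ (j′ , β′) →
                  (∀ i → class j β i ∈ p) → (∀ i → class j′ β′ i ∈ p) → a + a ≤ ∣ p ∣
    classes-≤∣∣ {j} {β} {j′} {β′} distinct ∈p ∈p′ =
      disjoint-injective⇒+≤∣∣ (class j β) (class j′ β′)
      (λ {i} {i′} eq → proj₂ (class-injective j β i j β i′ eq))
      (λ {i} {i′} eq → proj₂ (class-injective j′ β′ i j′ β′ i′ eq))
      (λ i i′ eq → distinct (proj₁ (class-injective j β i j′ β′ i′ eq))) ∈p ∈p′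

    record Live (j : Fin K) (β : Parity) : Set where
      constructor live
      field
        index : Fin a
        ∉D    : class j β index ∉ D

    live? : ∀ j β → Dec (Live j β)
    live? j β with Fin.any? (λ i → ¬? (class j β i ∈? D))
    ... | yes (i , i∉D) = yes (live i i∉D)
    ... | no  none      = no λ (live i i∉D) → none (i , i∉D)

    dead⇒∈ : ∀ {j β} → ¬ Live j β → ∀ i → class j β i ∈ D
    dead⇒∈ {j} {β} dead i = decidable-stable (class j β i ∈? D) (λ ∉D → dead (live i ∉D))

    outside-two-dead⇒∉ : ∀ {j β j′ β′} → ∣ D ∣ ≤ a + a → (j , β) ≢ (j′ , β′) → ¬ Live j β → ¬ Live j′ β′ →
                         ∀ e → (∀ i → class j β i ≢ e) → (∀ i → class j′ β′ i ≢ e) → e ∉ D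
    outside-two-dead⇒∉ ∣D∣≤2a distinct dead dead′ e ≢e ≢e′ e∈D = <-irrefl refl (begin-strict
      a + a       ≤⟨ classes-≤∣∣ distinct (λ i → x∈p∧x≢y⇒x∈p-y (dead⇒∈ dead i) (≢e i))
                                     (λ i → x∈p∧x≢y⇒x∈p-y (dead⇒∈ dead′ i) (≢e′ i)) ⟩
      ∣ D - e ∣   <⟨ x∈p⇒∣p-x∣<∣p∣ e∈D ⟩
      ∣ D ∣       ≤⟨ ∣D∣≤2a ⟩
      a + a       ∎)
      where open ≤-Reasoning

module Even (K′ t′ a′ : ℕ) where

  a : ℕ
  a = suc a′

  open Halves a

  evenClassType : Parity → EdgeType
  evenClassType 0ℙ = block
  evenClassType 1ℙ = shifted 0ℙ

  open Construction K′ t′ (a + a) (evenClassType ∘ side) public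

  module _ (D : Subset (K * (a + a))) (∣D∣<r : ∣ D ∣ < a + a) where
    open Deletion D ∣D∣<r
    open Classes a half half-injective D

    type-half : ∀ β i → evenClassType (side (half β i)) ≡ evenClassType β
    type-half β i = cong evenClassType (side-half β i)

    no-two-dead : ∀ {j β j′ β′} → (j , β) ≢ (j′ , β′) → ¬ Live j β → ¬ Live j′ β′ → ⊥
    no-two-dead distinct dead dead′ = <⇒≱ ∣D∣<r (classes-≤∣∣ distinct (dead⇒∈ dead) (dead⇒∈ dead′))

    BlockLive : Fin K → Set
    BlockLive j = Live j 0ℙ × Live j 1ℙ

    dead-class : ∀ {j} → ¬ BlockLive j → ∃ λ β → ¬ Live j β
    dead-class {j} ¬live with live? j 0ℙ
    ... | yes live₀ = 1ℙ , λ live₁ → ¬live (live₀ , live₁)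
    ... | no  dead₀ = 0ℙ , dead₀

    at-most-one-dead-block : ∃ λ d → ∀ j → j ≢ d → BlockLive j
    at-most-one-dead-block with allButOne⊎twoFail (λ j → live? j 0ℙ ×-dec live? j 1ℙ)
    ... | inj₁ found = found
    ... | inj₂ (j , j′ , j≢j′ , ¬live , ¬live′) with dead-class ¬live | dead-class ¬live′
    ...   | _ , dead | _ , dead′ = ⊥-elim (no-two-dead (j≢j′ ∘ cong proj₁) dead dead′)

    step : ∀ {j} → BlockLive j → vertex j (slot 0ℙ) ~ vertex (next j) (slot 0ℙ)
    step {j} (live i₀ i₀∉D , live i₁ i₁∉D) =
      ~-trans (within-block~ j (half 0ℙ i₀) (type-half 0ℙ i₀) i₀∉D (slot 0ℙ) (slot 1ℙ))
              (across~ j (half 1ℙ i₁) 1ℙ (type-half 1ℙ i₁) i₁∉D)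

    spine : ∀ j → vertex zero (slot 0ℙ) ~ vertex j (slot 0ℙ)
    spine = let d , links = at-most-one-dead-block in
            ring-connected ~-setoid (λ j → vertex j (slot 0ℙ)) d (λ j j≢d → step (links j j≢d))

    some-live-class : ∀ j → Dec (Live j 0ℙ) → Dec (Live j 1ℙ) → Live j 0ℙ ⊎ Live j 1ℙ
    some-live-class j (yes live₀) _           = inj₁ live₀
    some-live-class j (no _)      (yes live₁) = inj₂ live₁
    some-live-class j (no dead₀)  (no dead₁)  = ⊥-elim (no-two-dead (λ ()) dead₀ dead₁)

    slot₁~hub : ∀ j → Live j 0ℙ ⊎ Live j 1ℙ → vertex j (slot 1ℙ) ~ vertex zero (slot 0ℙ)
    slot₁~hub j (inj₁ (live i i∉D)) =
      ~-trans (within-block~ j (half 0ℙ i) (type-half 0ℙ i) i∉D (slot 1ℙ) (slot 0ℙ)) (~-sym (spine j))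
    slot₁~hub j (inj₂ (live i i∉D)) =
      ~-trans (across~ j (half 1ℙ i) 1ℙ (type-half 1ℙ i) i∉D) (~-sym (spine (next j)))

    slot~hub : ∀ j β → vertex j (slot β) ~ vertex zero (slot 0ℙ)
    slot~hub j 0ℙ = ~-sym (spine j)
    slot~hub j 1ℙ = slot₁~hub j (some-live-class j (live? j 0ℙ) (live? j 1ℙ))

    connected : ∀ u v → u ~ v
    connected = anchored-slots⇒connected slot~hub

  H-edgeConnected : EdgeConnected (a + a) H
  H-edgeConnected = reachable⇒edgeConnected H connected

module Odd (K₂ t′ a′ : ℕ) (a≤K₂ : suc a′ ≤ K₂) where

  a : ℕ
  a = suc a′

  open Halves a

  oddType : Fin (suc (a + a)) → EdgeType
  oddType zero    = block
  oddType (suc q) = shifted (side q)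

  open Construction (K₂ + suc K₂) t′ (suc (a + a)) oddType public

  K-even : parity K ≡ 0ℙ
  K-even = trans (+-homo-+ (suc K₂) (suc K₂)) (ℙ.p+p≡0ℙ (parity (suc K₂)))

  r≤K : suc (a + a) ≤ K
  r≤K = s≤s (+-mono-≤ a≤K₂ (m≤n⇒m≤1+n a≤K₂))

  rung : Fin K → Fin (K * suc (a + a))
  rung j = edgeAt j zero

  rung-injective : Injective _≡_ _≡_ rung
  rung-injective {j} {j′} eq = proj₁ (Fin.combine-injective j zero j′ zero eq)

  ringSlot : Parity → Fin K → Parity
  ringSlot o j = o ℙ+ parity (toℕ j)

  -- Ring o meets block j at slot o + parity j; it closes up because K is even.
  onRing : Parity → Fin K → Fin (K * t)
  onRing o j = vertex j (slot (ringSlot o j))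

  ringSlot-next : ∀ o j → ringSlot o (next j) ≡ ringSlot o j ⁻¹
  ringSlot-next o j = trans (cong (o ℙ+_) (parity-next K-even j)) (+⁻¹ o)
    where
    +⁻¹ : ∀ o {p} → o ℙ+ p ⁻¹ ≡ (o ℙ+ p) ⁻¹
    +⁻¹ 0ℙ = refl
    +⁻¹ 1ℙ = refl

  on-own-ring : ∀ j β → onRing (β ℙ+ parity (toℕ j)) j ≡ vertex j (slot β)
  on-own-ring j β = cong (vertex j ∘ slot) (begin
    (β ℙ+ π) ℙ+ π ≡⟨ ℙ.+-assoc β π π ⟩
    β ℙ+ (π ℙ+ π) ≡⟨ cong (β ℙ+_) (ℙ.p+p≡0ℙ π) ⟩
    β ℙ+ 0ℙ       ≡⟨ ℙ.+-identityʳ β ⟩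
    β             ∎)
    where
    open ≡-Reasoning
    π = parity (toℕ j)

  suc-half-injective : ∀ {β β′ i i′} → suc (half β i) ≡ suc (half β′ i′) → β ≡ β′ × i ≡ i′
  suc-half-injective = half-injective ∘ suc-injective

  ring-classes-distinct : ∀ o {j j′} → j′ ≡ j → ringSlot o j′ ⁻¹ ≢ ringSlot (o ⁻¹) j ⁻¹
  ring-classes-distinct o {j} refl same-slot =
    ℙ.p≢p⁻¹ o (ℙ.+-cancelʳ-≡ (parity (toℕ j)) o (o ⁻¹) (ℙ.⁻¹-injective same-slot))

  module _ (D : Subset (K * suc (a + a))) (∣D∣<r : ∣ D ∣ < suc (a + a)) where
    open Deletion D ∣D∣<r
    open Classes a (λ β → suc ∘ half β) suc-half-injective D
    open import Relation.Binary.Reasoning.Setoid ~-setoid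

    RingLive : Parity → Fin K → Set
    RingLive o j = Live j (ringSlot o j ⁻¹)

    AtMostOneBroken TwoBroken : Parity → Set
    AtMostOneBroken o = ∃ λ d → ∀ j → j ≢ d → RingLive o j
    TwoBroken       o = ∃₂ λ j j′ → j ≢ j′ × ¬ RingLive o j × ¬ RingLive o j′

    step : ∀ o j → RingLive o j → onRing o j ~ onRing o (next j)
    step o j (live i i∉D) =
      subst (onRing o j ~_) (cong (vertex (next j) ∘ slot) (sym (ringSlot-next o j)))
            (across~ j (suc (half (ringSlot o j ⁻¹) i)) (ringSlot o j) (cong shifted (side-half _ i)) i∉D)

    onRing-connected : ∀ o → AtMostOneBroken o → ∀ j → onRing o zero ~ onRing o j
    onRing-connected o (d , links) = ring-connected ~-setoid (onRing o) d (λ j j≢d → step o j (links j j≢d))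

    rings-joined : AtMostOneBroken 0ℙ → AtMostOneBroken 1ℙ → (∃ λ j → rung j ∉ D) →
                    onRing 1ℙ zero ~ onRing 0ℙ zero
    rings-joined links₀ links₁ (j₀ , rung-live) = begin
      onRing 1ℙ zero ≈⟨ onRing-connected 1ℙ links₁ j₀ ⟩
      onRing 1ℙ j₀   ≈⟨ within-block~ j₀ zero refl rung-live _ _ ⟩
      onRing 0ℙ j₀   ≈⟨ ~-sym (onRing-connected 0ℙ links₀ j₀) ⟩
      onRing 0ℙ zero ∎

    both-rings-connected : AtMostOneBroken 0ℙ → AtMostOneBroken 1ℙ →
                            ∀ j β → vertex j (slot β) ~ onRing 0ℙ zero
    both-rings-connected links₀ links₁ j β = begin
      vertex j (slot β) ≡⟨ sym (on-own-ring j β) ⟩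
      onRing o j       ≈⟨ ~-sym (onRing-connected o (links o) j) ⟩
      onRing o zero    ≈⟨ to-base o ⟩
      onRing 0ℙ zero   ∎
      where
      o = β ℙ+ parity (toℕ j)
      links : ∀ o → AtMostOneBroken o
      links 0ℙ = links₀
      links 1ℙ = links₁
      to-base : ∀ o → onRing o zero ~ onRing 0ℙ zero
      to-base 0ℙ = ~-refl
      to-base 1ℙ = rings-joined links₀ links₁ (injective⇒∃∉ rung rung-injective (<-≤-trans ∣D∣<r r≤K))

    other-onRing-connected : ∀ o → TwoBroken o → ∀ j β → vertex j (slot β) ~ onRing (o ⁻¹) zero
    other-onRing-connected o (j₁ , j₂ , j₁≢j₂ , dead₁ , dead₂) j β = begin
      vertex j (slot β)    ≈⟨ within-block~ j zero refl (rung-live j) _ _ ⟩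
      onRing (o ⁻¹) j     ≈⟨ ~-sym (onRing-connected (o ⁻¹) (zero , λ j′ _ → other-live j′) j) ⟩
      onRing (o ⁻¹) zero  ∎
      where
      outside : ∀ e → (∀ i → class j₁ (ringSlot o j₁ ⁻¹) i ≢ e) →
                      (∀ i → class j₂ (ringSlot o j₂ ⁻¹) i ≢ e) → e ∉ D
      outside = outside-two-dead⇒∉ (s≤s⁻¹ ∣D∣<r) (j₁≢j₂ ∘ cong proj₁) dead₁ dead₂
      rung-live : ∀ j → rung j ∉ D
      rung-live j = outside (rung j) (class≢rung j₁) (class≢rung j₂)
        where
        class≢rung : ∀ j′ i → class j′ (ringSlot o j′ ⁻¹) i ≢ rung j
        class≢rung j′ i eq =
          Fin.0≢1+n (sym (proj₂ (Fin.combine-injective j′ (suc (half (ringSlot o j′ ⁻¹) i)) j zero eq)))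
      other-live : ∀ j → RingLive (o ⁻¹) j
      other-live j = live zero (outside _ (other≢ j₁) (other≢ j₂))
        where
        other≢ : ∀ j′ i → class j′ (ringSlot o j′ ⁻¹) i ≢ class j (ringSlot (o ⁻¹) j ⁻¹) zero
        other≢ j′ i eq = let same-class = proj₁ (class-injective j′ _ i j _ zero eq) in
          ring-classes-distinct o (cong proj₁ same-class) (cong proj₂ same-class)

    connected-from : AtMostOneBroken 0ℙ ⊎ TwoBroken 0ℙ → AtMostOneBroken 1ℙ ⊎ TwoBroken 1ℙ →
                     ∀ u v → u ~ v
    connected-from (inj₂ broken₀) _ =
      anchored-slots⇒connected (other-onRing-connected 0ℙ broken₀)
    connected-from (inj₁ _) (inj₂ broken₁) =
      anchored-slots⇒connected (other-onRing-connected 1ℙ broken₁)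
    connected-from (inj₁ links₀) (inj₁ links₁) =
      anchored-slots⇒connected (both-rings-connected links₀ links₁)

    connected : ∀ u v → u ~ v
    connected = connected-from (allButOne⊎twoFail (λ j → live? j (ringSlot 0ℙ j ⁻¹)))
                               (allButOne⊎twoFail (λ j → live? j (ringSlot 1ℙ j ⁻¹)))

  H-edgeConnected : EdgeConnected (suc (a + a)) H
  H-edgeConnected = reachable⇒edgeConnected H connected

data Halving : ℕ → Set where
  even : ∀ a → Halving (a + a)
  odd  : ∀ a → Halving (suc (a + a))

halving : ∀ n → Halving n
halving zero    = even 0
halving (suc n) with halving n
... | even a = odd a
... | odd  a = subst Halving (cong suc (+-suc a a)) (even (suc a))

EdgeConnectedRegularUniform : ℕ → ℕ → ℕ → Set
EdgeConnectedRegularUniform r t N =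
  Σ Hypergraph λ H → N ≤ n H × EdgeConnected r H × Regular r H × Uniform t H

edgeConnectedRegularUniform : ∀ r t → 2 ≤ r → 2 ≤ t → ∀ N → EdgeConnectedRegularUniform r t N
edgeConnectedRegularUniform _ 1 _ (s≤s ()) _
edgeConnectedRegularUniform r (suc (suc t′)) 2≤r _ N with halving r
... | even (suc a′) = H , N≤n , H-edgeConnected , H-regular , H-uniform
  where
  open Even N t′ a′
  N≤n : N ≤ K * t
  N≤n = ≤-trans (n≤1+n N) (m≤m*n K t)
... | odd (suc a′) = H , N≤n , H-edgeConnected , H-regular , H-uniform
  where
  open Odd (N + suc a′) t′ a′ (m≤n+m (suc a′) N)
  N≤n : N ≤ K * t
  N≤n = begin
    N                             ≤⟨ m≤m+n N (suc a′) ⟩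
    N + suc a′                    ≤⟨ m≤m+n (N + suc a′) (suc (N + suc a′)) ⟩
    N + suc a′ + suc (N + suc a′) <⟨ n<1+n _ ⟩
    K                             ≤⟨ m≤m*n K t ⟩
    K * t                         ∎
    where open ≤-Reasoning
edgeConnectedRegularUniform .0 _ () _ _ | even zero
edgeConnectedRegularUniform .1 _ (s≤s ()) _ _ | odd zero

theorem4 : (r t : ℕ) → 2 ≤ r → 2 ≤ t → (N : ℕ) →
    Σ Hypergraph λ H → N ≤ n H × EdgeConnected r H × Regular r H × Uniform t H ×
      ((k : ℕ) → 2 * r < k * t → ¬ BergeFactor k H)
theorem4 r t 2≤r 2≤t N with edgeConnectedRegularUniform r t 2≤r 2≤t (suc N)
... | H , N<n , connected , regular , uniform =
  H , <⇒≤ N<n , connected , regular , uniform ,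
  λ k → regular∧uniform⇒¬BergeFactor H regular uniform (≤-trans (s≤s z≤n) N<n)
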